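{- For every integer $n\geq 2$, there exists a $4$-colouring of $F_{n^3}\boxtimes F_{n^3}$ with clustering at most $7n^2$.
   Context: All graphs are finite and simple. The fan $F_m$ is the graph obtained from the path on $m$ vertices by adding one new vertex adjacent to every vertex of the path. A colouring of a graph assigns a colour to each vertex (adjacent vertices may receive the same colour); a $c$-colouring uses at most $c$ colours. A monochromatic component is a connected component of the subgraph induced by the vertices of one colour. A colouring has clustering at most $k$ if every monochromatic component has at most $k$ vertices. The strong product $G\boxtimes H$ has vertex set $V(G)\times V(H)$, with distinct $(u,v),(u',v')$ adjacent iff ($u=u'$ and $vv'\in E(H)$) or ($v=v'$ and $uu'\in E(G)$) or ($uu'\in E(G)$ and $vv'\in E(H)$). -}

module Defs where

open import Level using (0ℓ)
open import Data.Nat using (ℕ; suc; _≤_)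
open import Data.Fin using (Fin; toℕ)
open import Data.Maybe using (Maybe; just; nothing)
open import Data.Product using (_×_; _,_)
open import Data.Sum using (_⊎_)
open import Data.Empty using (⊥)
open import Data.Unit using (⊤)
open import Data.List using (List; length)
open import Data.List.Relation.Unary.All using (All)
open import Data.List.Relation.Unary.Unique.Propositional using (Unique)
open import Relation.Binary.PropositionalEquality using (_≡_)

record Graph : Set₁ where
  field
    V   : Set
    Adj : V → V → Set

open Graph public

PathAdj : ∀ {m} → Fin m → Fin m → Set
PathAdj i j = (toℕ j ≡ suc (toℕ i)) ⊎ (toℕ i ≡ suc (toℕ j))

-- Fan F_m : path on m vertices (just i) plus apex (nothing) adjacent to all of them.
FanAdj : ∀ {m} → Maybe (Fin m) → Maybe (Fin m) → Set
FanAdj nothing  nothing  = ⊥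
FanAdj nothing  (just _) = ⊤
FanAdj (just _) nothing  = ⊤
FanAdj (just i) (just j) = PathAdj i j

Fan : ℕ → Graph
Fan m = record { V = Maybe (Fin m) ; Adj = FanAdj }

_⊠_ : Graph → Graph → Graph
G ⊠ H = record
  { V   = V G × V H
  ; Adj = λ { (u , v) (u' , v') →
              ((u ≡ u') × Adj H v v')
            ⊎ ((v ≡ v') × Adj G u u')
            ⊎ (Adj G u u' × Adj H v v') } }

data MonoConn (G : Graph) {C : Set} (c : V G → C) : V G → V G → Set where
  here : ∀ {u} → MonoConn G c u u
  step : ∀ {u v w} → MonoConn G c u v → Adj G v w → c v ≡ c w → MonoConn G c u w

Clustering≤ : (G : Graph) {C : Set} → (V G → C) → ℕ → Set
Clustering≤ G c k = ∀ (v : V G) (xs : List (V G)) →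
  Unique xs → All (MonoConn G c v) xs → length xs ≤ k

-- Cut the path 0, …, n³ − 1 into n² blocks of n consecutive vertices, the first
-- vertex of a block being a cut.  In the product of the two paths, vertices on a
-- cut row get colour 0, on a cut column colour 1 and all others colour 2, so each
-- colour-2 component stays inside one n × n block.  A crossing of a cut row and a
-- cut column goes to the row or to the column according to parity, which breaks
-- every cut line into segments of fewer than 2n vertices.  A vertex (apex, y) with
-- y in the middle of its block (offset ∉ {0, 1, n − 1}) touches no cut row, so it
-- takes colour 0 and its component has fewer than n vertices; symmetrically for
-- colour 1.  The apex and the at most 6n² other vertices of its row and column get
-- colour 3.  Each component is certified by a key, constant along monochromatic
-- edges, and a position below 7n², which together determine the vertex.
module Submission where

open import Defs
open import Data.Nat using (ℕ; _≤_; _*_; _^_)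
open import Data.Fin using (Fin)
open import Data.Product using (Σ)

open import Data.Nat
  using (zero; suc; pred; _+_; _∸_; _<_; _<?_; _≤?_; _≟_; z≤n; s≤s; z<s; NonZero; >-nonZero; >-nonZero⁻¹; parity)
open import Data.Nat.Properties
open import Data.Nat.DivMod
open import Data.Nat.Divisibility using (n∣m*n)
open import Data.Parity.Base using (Parity; 0ℙ; 1ℙ; _⁻¹)
open import Data.Parity.Properties using (suc-homo-⁻¹; ⁻¹-selfInverse)
open import Data.Fin using (zero; suc; toℕ; fromℕ<; #_)
open import Data.Fin.Properties using (pigeonhole; fromℕ<-injective; toℕ-injective; toℕ<n)
  renaming (<⇒≢ to <⇒≢ᶠ)
open import Data.Maybe using (Maybe; just; nothing; map)
open import Data.Maybe.Properties using (map-injective)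
open import Data.Maybe.Relation.Unary.All as MaybeAll using (just; nothing)
open import Data.Product using (_×_; _,_; proj₁; proj₂; ∃; -,_)
open import Data.Product.Properties using (,-injective)
open import Data.Sum using (_⊎_; inj₁; inj₂)
open import Data.Unit using (⊤; tt)
open import Data.Empty using (⊥-elim)
open import Data.List using (List; _∷_; length; lookup)
open import Data.List.Relation.Unary.All as All using (All)
open import Data.List.Relation.Unary.AllPairs using (_∷_)
open import Data.List.Relation.Unary.Unique.Propositional using (Unique)
open import Data.List.Membership.Propositional.Properties using (∈-lookup)
open import Relation.Binary.PropositionalEquality
open import Relation.Nullary using (¬_; yes; no; contradiction)
open import Relation.Nullary.Decidable using (Dec; _×-dec_)

lookup-injective : ∀ {A : Set} {xs : List A} → Unique xs →
  ∀ {i j} → lookup xs i ≡ lookup xs j → i ≡ j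
lookup-injective (_ ∷ _) {zero} {zero} _ = refl
lookup-injective (x∉xs ∷ _) {zero} {suc j} eq = ⊥-elim (All.lookup x∉xs (∈-lookup j) eq)
lookup-injective (x∉xs ∷ _) {suc i} {zero} eq = ⊥-elim (All.lookup x∉xs (∈-lookup i) (sym eq))
lookup-injective (_ ∷ u) {suc i} {suc j} eq = cong suc (lookup-injective u eq)

module _ (G : Graph) {C K : Set} (colour : V G → C) (label : V G → K) (position : V G → ℕ) {k : ℕ}
  (label-mono : ∀ {v w} → Adj G v w → colour v ≡ colour w → label v ≡ label w)
  (label-position-injective : ∀ {v w} → label v ≡ label w → position v ≡ position w → v ≡ w)
  (position<k : ∀ v → position v < k)
  where

  MonoConn⇒≡label : ∀ {v w} → MonoConn G colour v w → label v ≡ label w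
  MonoConn⇒≡label here = refl
  MonoConn⇒≡label (step conn adj eq) = trans (MonoConn⇒≡label conn) (label-mono adj eq)

  clustering≤-by-labelling : Clustering≤ G colour k
  clustering≤-by-labelling v xs xs-unique xs-conn with length xs ≤? k
  ... | yes |xs|≤k = |xs|≤k
  ... | no |xs|≰k with pigeonhole (≰⇒> |xs|≰k) (λ i → fromℕ< (position<k (lookup xs i)))
  ...   | i , j , i<j , same-slot = contradiction (lookup-injective xs-unique same-vertex) (<⇒≢ᶠ i<j)
    where
    label-v : ∀ i → label v ≡ label (lookup xs i)
    label-v i = MonoConn⇒≡label (All.lookup xs-conn (∈-lookup i))

    same-vertex : lookup xs i ≡ lookup xs j
    same-vertex = label-position-injective (trans (sym (label-v i)) (label-v j))
      (fromℕ<-injective _ _ _ _ same-slot)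

[m+n*d]%d≡m : ∀ {m} n {d} .{{_ : NonZero d}} → m < d → (m + n * d) % d ≡ m
[m+n*d]%d≡m {m} n {d} m<d = trans ([m+kn]%n≡m%n m n d) (m<n⇒m%n≡m m<d)

[m+n*d]/d≡n : ∀ {m} n {d} .{{_ : NonZero d}} → m < d → (m + n * d) / d ≡ n
[m+n*d]/d≡n {m} n {d} m<d = begin
  (m + n * d) / d   ≡⟨ +-distrib-/-∣ʳ m (n∣m*n n) ⟩
  m / d + n * d / d ≡⟨ cong₂ _+_ (m<n⇒m/n≡0 m<d) (m*n/n≡m n d) ⟩
  n                 ∎
  where open ≡-Reasoning

parity-suc : ∀ m → parity (suc m) ≡ parity m ⁻¹
parity-suc m = sym (⁻¹-selfInverse (suc-homo-⁻¹ m))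

data Close : ℕ → ℕ → Set where
  same : ∀ {x} → Close x x
  next : ∀ {x} → Close x (suc x)
  prev : ∀ {x} → Close (suc x) x

Close-sym : ∀ {x y} → Close x y → Close y x
Close-sym same = same
Close-sym next = prev
Close-sym prev = next

module Blocks (p : ℕ) (1<p : 1 < p) where

  instance
    p-nonZero : NonZero p
    p-nonZero = >-nonZero (<-trans z<s 1<p)

  block offset : ℕ → ℕ
  block x = x / p
  offset x = x % p

  offset<p : ∀ x → offset x < p
  offset<p x = m%n<n x p

  offset+block*p : ∀ x → offset x + block x * p ≡ x
  offset+block*p x = sym (m≡m%n+[m/n]*n x p)

  block-offset-unique : ∀ {x r q} → r < p → r + q * p ≡ x → block x ≡ q × offset x ≡ r
  block-offset-unique {q = q} r<p refl = [m+n*d]/d≡n q r<p , [m+n*d]%d≡m q r<p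

  Cut : ℕ → Set
  Cut x = offset x ≡ 0

  cut? : ∀ x → Dec (Cut x)
  cut? x = offset x ≟ 0

  block-offset-suc : ∀ x → (block (suc x) ≡ block x × offset (suc x) ≡ suc (offset x))
                   ⊎ (suc (offset x) ≡ p × block (suc x) ≡ suc (block x) × Cut (suc x))
  block-offset-suc x with suc (offset x) <? p
  ... | yes 1+r<p = inj₁ (block-offset-unique 1+r<p (cong suc (offset+block*p x)))
  ... | no 1+r≮p = inj₂ (1+r≡p , block-offset-unique (>-nonZero⁻¹ p) carry)
    where
    1+r≡p : suc (offset x) ≡ p
    1+r≡p = ≤∧≮⇒≡ (offset<p x) 1+r≮p

    carry : p + block x * p ≡ suc x
    carry = trans (cong (_+ block x * p) (sym 1+r≡p)) (cong suc (offset+block*p x))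

  block-suc : ∀ x → ¬ Cut (suc x) → block (suc x) ≡ block x
  block-suc x ¬cut with block-offset-suc x
  ... | inj₁ (same-block , _) = same-block
  ... | inj₂ (_ , _ , cut) = contradiction cut ¬cut

  Cut⇒offset-suc≡1 : ∀ {x} → Cut x → offset (suc x) ≡ 1
  Cut⇒offset-suc≡1 {x} cut with block-offset-suc x
  ... | inj₁ (_ , offset-suc) = trans offset-suc (cong suc cut)
  ... | inj₂ (1+r≡p , _) = contradiction (trans (cong suc (sym cut)) 1+r≡p) (<⇒≢ 1<p)

  block-close : ∀ {x y} → Close x y → ¬ Cut x → ¬ Cut y → block x ≡ block y
  block-close same _ _ = refl
  block-close next _ ¬cut = sym (block-suc _ ¬cut)
  block-close prev ¬cut _ = block-suc _ ¬cut

  cut-close : ∀ {x y} → Close x y → Cut x → Cut y → x ≡ y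
  cut-close same _ _ = refl
  cut-close next cut cut′ with () ← trans (sym (Cut⇒offset-suc≡1 cut)) cut′
  cut-close prev cut cut′ with () ← trans (sym (Cut⇒offset-suc≡1 cut′)) cut

  Mid : ℕ → Set
  Mid x = 2 ≤ offset x × suc (offset x) < p

  mid? : ∀ x → Dec (Mid x)
  mid? x = 2 ≤? offset x ×-dec suc (offset x) <? p

  Mid⇒¬Cut : ∀ {x} → Mid x → ¬ Cut x
  Mid⇒¬Cut (2≤r , _) cut with () ← subst (2 ≤_) cut 2≤r

  Mid-close⇒¬Cut : ∀ {x y} → Close x y → Mid x → ¬ Cut y
  Mid-close⇒¬Cut same mid = Mid⇒¬Cut mid
  Mid-close⇒¬Cut {x} next (_ , 1+r<p) cut with block-offset-suc x
  ... | inj₁ (_ , offset-suc) with () ← trans (sym offset-suc) cut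
  ... | inj₂ (1+r≡p , _) = contradiction 1+r≡p (<⇒≢ 1+r<p)
  Mid-close⇒¬Cut prev (2≤r , _) cut with s≤s () ← subst (2 ≤_) (Cut⇒offset-suc≡1 cut) 2≤r

  -- The line through a cut y (c = block y) or through a cut x (c = 1 + block x)
  -- owns the crossings z with block z + c even, so each crossing belongs to exactly
  -- one of its two lines.  A vertex z of a line lies in the segment of the owned
  -- crossing among blocks block z and block z + 1; segments have < 2p vertices.
  OnSegment : ℕ → ℕ → Set
  OnSegment c z = ¬ Cut z ⊎ parity (block z + c) ≡ 0ℙ

  ownedCrossing : Parity → ℕ → ℕ
  ownedCrossing 0ℙ q = q
  ownedCrossing 1ℙ q = suc q

  segment : ℕ → ℕ → ℕ
  segment c z = ownedCrossing (parity (block z + c)) (block z)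

  segment-suc : ∀ c z → OnSegment c (suc z) → segment c z ≡ segment c (suc z)
  segment-suc c z on with block-offset-suc z
  ... | inj₁ (same-block , _) rewrite same-block = refl
  ... | inj₂ (_ , next-block , cut) with on
  ...   | inj₁ ¬cut = contradiction cut ¬cut
  ...   | inj₂ owned = begin
    ownedCrossing (parity (block z + c)) (block z)
      ≡⟨ cong (λ π → ownedCrossing π (block z)) odd ⟩
    suc (block z)
      ≡⟨ sym next-block ⟩
    block (suc z)
      ≡⟨ cong (λ π → ownedCrossing π (block (suc z))) (sym owned) ⟩
    ownedCrossing (parity (block (suc z) + c)) (block (suc z))
      ∎
    where
    open ≡-Reasoning
    odd : parity (block z + c) ≡ 1ℙ
    odd = sym (⁻¹-selfInverse (trans (sym (parity-suc (block z + c)))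
            (subst (λ q → parity (q + c) ≡ 0ℙ) next-block owned)))

  segment-close : ∀ {c z z′} → Close z z′ → OnSegment c z → OnSegment c z′ →
                  segment c z ≡ segment c z′
  segment-close same _ _ = refl
  segment-close next _ on′ = segment-suc _ _ on′
  segment-close prev on _ = sym (segment-suc _ _ on)

  -- r in the block before the owned crossing, p + r in the block it starts.
  positionIn : Parity → ℕ → ℕ
  positionIn 0ℙ r = p + r
  positionIn 1ℙ r = r

  segmentPosition : ℕ → ℕ → ℕ
  segmentPosition c z = positionIn (parity (block z + c)) (offset z)

  segmentPoint : ℕ → ℕ → ℕ
  segmentPoint s e with e <? p
  ... | yes _ = e + pred s * p
  ... | no _ = (e ∸ p) + s * p

  segmentPoint-segment : ∀ c z → segmentPoint (segment c z) (segmentPosition c z) ≡ z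
  segmentPoint-segment c z with parity (block z + c)
  ... | 0ℙ with p + offset z <? p
  ...   | yes p+r<p = contradiction p+r<p (m+n≮m p (offset z))
  ...   | no _ = trans (cong (_+ block z * p) (m+n∸m≡n p (offset z))) (offset+block*p z)
  segmentPoint-segment c z | 1ℙ with offset z <? p
  ...   | yes _ = offset+block*p z
  ...   | no r≮p = contradiction (offset<p z) r≮p

  segmentPosition<2p : ∀ c z → segmentPosition c z < p + p
  segmentPosition<2p c z with parity (block z + c)
  ... | 0ℙ = +-monoʳ-< p (offset<p z)
  ... | 1ℙ = <-≤-trans (offset<p z) (m≤m+n p p)

FanClose : Maybe ℕ → Maybe ℕ → Set
FanClose (just x) (just y) = Close x y
FanClose _ _ = ⊤

FanClose-refl : ∀ a → FanClose a a
FanClose-refl nothing = tt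
FanClose-refl (just _) = same

data Key : Set where
  apexKey : Key
  topKey leftKey : ℕ → Key
  blockKey rowKey columnKey : ℕ → ℕ → Key

module Colouring (p : ℕ) (1<p : 1 < p) where
  open Blocks p 1<p public

  -- nothing is the apex; the index of a shape is the colour of its vertices.
  data Shape : Maybe ℕ → Maybe ℕ → Fin 4 → Set where
    apex        : Shape nothing nothing (# 3)
    top         : ∀ {y} → Mid y → Shape nothing (just y) (# 0)
    top-border  : ∀ {y} → ¬ Mid y → Shape nothing (just y) (# 3)
    left        : ∀ {x} → Mid x → Shape (just x) nothing (# 1)
    left-border : ∀ {x} → ¬ Mid x → Shape (just x) nothing (# 3)
    interior    : ∀ {x y} → ¬ Cut x → ¬ Cut y → Shape (just x) (just y) (# 2)
    row         : ∀ {x y} → Cut y → OnSegment (block y) x → Shape (just x) (just y) (# 0)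
    column      : ∀ {x y} → Cut x → OnSegment (suc (block x)) y → Shape (just x) (just y) (# 1)

  shape : ∀ a b → ∃ (Shape a b)
  shape nothing nothing = -, apex
  shape nothing (just y) with mid? y
  ... | yes mid = -, top mid
  ... | no ¬mid = -, top-border ¬mid
  shape (just x) nothing with mid? x
  ... | yes mid = -, left mid
  ... | no ¬mid = -, left-border ¬mid
  shape (just x) (just y) with cut? x | cut? y
  ... | no ¬cut | no ¬cut′ = -, interior ¬cut ¬cut′
  ... | no ¬cut | yes cut′ = -, row cut′ (inj₁ ¬cut)
  ... | yes cut | no ¬cut′ = -, column cut (inj₁ ¬cut′)
  ... | yes cut | yes cut′ with parity (block x + block y) in eq
  ...   | 0ℙ = -, row cut′ (inj₂ eq)
  ...   | 1ℙ = -, column cut (inj₂ column-owns)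
    where
    column-owns : parity (block y + suc (block x)) ≡ 0ℙ
    column-owns = begin
      parity (block y + suc (block x)) ≡⟨ cong parity (+-suc (block y) (block x)) ⟩
      parity (suc (block y + block x)) ≡⟨ cong (λ m → parity (suc m)) (+-comm (block y) (block x)) ⟩
      parity (suc (block x + block y)) ≡⟨ parity-suc (block x + block y) ⟩
      parity (block x + block y) ⁻¹    ≡⟨ cong _⁻¹ eq ⟩
      0ℙ                               ∎
      where open ≡-Reasoning

  key : ∀ {a b c} → Shape a b c → Key
  key apex = apexKey
  key (top {y} _) = topKey (block y)
  key (top-border _) = apexKey
  key (left {x} _) = leftKey (block x)
  key (left-border _) = apexKey
  key (interior {x} {y} _ _) = blockKey (block x) (block y)
  key (row {x} {y} _ _) = rowKey (block y) (segment (block y) x)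
  key (column {x} {y} _ _) = columnKey (block x) (segment (suc (block x)) y)

  key-colour₃ : ∀ {a b} (s : Shape a b (# 3)) → key s ≡ apexKey
  key-colour₃ apex = refl
  key-colour₃ (top-border _) = refl
  key-colour₃ (left-border _) = refl

  key-close : ∀ {a a′ b b′ c} → FanClose a a′ → FanClose b b′ →
              (s : Shape a b c) (s′ : Shape a′ b′ c) → key s ≡ key s′
  key-close _ _ apex s′ = sym (key-colour₃ s′)
  key-close _ _ (top-border _) s′ = sym (key-colour₃ s′)
  key-close _ _ (left-border _) s′ = sym (key-colour₃ s′)
  key-close _ y~y′ (top mid) (top mid′) =
    cong topKey (block-close y~y′ (Mid⇒¬Cut mid) (Mid⇒¬Cut mid′))
  key-close _ y~y′ (top mid) (row cut′ _) = contradiction cut′ (Mid-close⇒¬Cut y~y′ mid)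
  key-close _ y~y′ (row cut _) (top mid′) = contradiction cut (Mid-close⇒¬Cut (Close-sym y~y′) mid′)
  key-close x~x′ y~y′ (row {y = y} cut on) (row cut′ on′) with refl ← cut-close y~y′ cut cut′ =
    cong (rowKey (block y)) (segment-close x~x′ on on′)
  key-close x~x′ _ (left mid) (left mid′) =
    cong leftKey (block-close x~x′ (Mid⇒¬Cut mid) (Mid⇒¬Cut mid′))
  key-close x~x′ _ (left mid) (column cut′ _) = contradiction cut′ (Mid-close⇒¬Cut x~x′ mid)
  key-close x~x′ _ (column cut _) (left mid′) = contradiction cut (Mid-close⇒¬Cut (Close-sym x~x′) mid′)
  key-close x~x′ y~y′ (column {x = x} cut on) (column cut′ on′) with refl ← cut-close x~x′ cut cut′ =
    cong (columnKey (block x)) (segment-close y~y′ on on′)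
  key-close x~x′ y~y′ (interior ¬cut ¬cut′) (interior ¬cut″ ¬cut‴) =
    cong₂ blockKey (block-close x~x′ ¬cut ¬cut″) (block-close y~y′ ¬cut′ ¬cut‴)

  same-colour⇒same-key : ∀ {a a′ b b′} → FanClose a a′ → FanClose b b′ →
    (s : ∃ (Shape a b)) (s′ : ∃ (Shape a′ b′)) → proj₁ s ≡ proj₁ s′ → key (proj₂ s) ≡ key (proj₂ s′)
  same-colour⇒same-key a~a′ b~b′ (_ , s) (_ , s′) refl = key-close a~a′ b~b′ s s′

  borderIndex : ℕ → ℕ
  borderIndex 0 = 0
  borderIndex 1 = 1
  borderIndex (suc (suc _)) = 2

  borderOffset : ℕ → ℕ
  borderOffset 0 = 0
  borderOffset 1 = 1
  borderOffset (suc (suc _)) = pred p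

  borderIndex<3 : ∀ r → borderIndex r < 3
  borderIndex<3 0 = s≤s z≤n
  borderIndex<3 1 = s≤s (s≤s z≤n)
  borderIndex<3 (suc (suc _)) = s≤s (s≤s (s≤s z≤n))

  borderOffset-borderIndex : ∀ x → ¬ Mid x → borderOffset (borderIndex (offset x)) ≡ offset x
  borderOffset-borderIndex x ¬mid with offset x | offset<p x | ¬mid
  ... | 0 | _ | _ = refl
  ... | 1 | _ | _ = refl
  ... | suc (suc r) | r<p | ¬mid′ =
    cong pred (sym (≤∧≮⇒≡ r<p (λ 1+r<p → ¬mid′ (s≤s (s≤s z≤n) , 1+r<p))))

  -- The six border vertices of the apex row and column over block q are
  -- numbered 1 + i + 6q, top ones with i < 3.
  borderPoint : ℕ → ℕ → Maybe ℕ × Maybe ℕ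
  borderPoint i q with i <? 3
  ... | yes _ = nothing , just (borderOffset i + q * p)
  ... | no _ = just (borderOffset (i ∸ 3) + q * p) , nothing

  point : Key → ℕ → Maybe ℕ × Maybe ℕ
  point apexKey zero = nothing , nothing
  point apexKey (suc m) = borderPoint (m % 6) (m / 6)
  point (topKey q) e = nothing , just (e + q * p)
  point (leftKey q) e = just (e + q * p) , nothing
  point (blockKey q q′) e = just (e / p + q * p) , just (e % p + q′ * p)
  point (rowKey q s) e = just (segmentPoint s e) , just (q * p)
  point (columnKey q s) e = just (q * p) , just (segmentPoint s e)

  position : ∀ {a b c} → Shape a b c → ℕ
  position apex = 0
  position (top {y} _) = offset y
  position (top-border {y} _) = suc (borderIndex (offset y) + block y * 6)
  position (left {x} _) = offset x
  position (left-border {x} _) = suc ((3 + borderIndex (offset x)) + block x * 6)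
  position (interior {x} {y} _ _) = offset y + offset x * p
  position (row {x} {y} _ _) = segmentPosition (block y) x
  position (column {x} {y} _ _) = segmentPosition (suc (block x)) y

  point-border : ∀ {i} q → i < 6 → point apexKey (suc (i + q * 6)) ≡ borderPoint i q
  point-border q i<6 = cong₂ borderPoint ([m+n*d]%d≡m q i<6) ([m+n*d]/d≡n q i<6)

  point-key-position : ∀ {a b c} (s : Shape a b c) → point (key s) (position s) ≡ (a , b)
  point-key-position apex = refl
  point-key-position (top {y} _) = cong (λ y → nothing , just y) (offset+block*p y)
  point-key-position (top-border {y} ¬mid)
    rewrite point-border (block y) (<-≤-trans (borderIndex<3 (offset y)) (m≤m+n 3 3))
    with borderIndex (offset y) <? 3
  ... | yes _ = cong (λ y → nothing , just y) (begin
    borderOffset (borderIndex (offset y)) + block y * p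
      ≡⟨ cong (_+ block y * p) (borderOffset-borderIndex y ¬mid) ⟩
    offset y + block y * p
      ≡⟨ offset+block*p y ⟩
    y ∎)
    where open ≡-Reasoning
  ... | no i≮3 = contradiction (borderIndex<3 (offset y)) i≮3
  point-key-position (left {x} _) = cong (λ x → just x , nothing) (offset+block*p x)
  point-key-position (left-border {x} ¬mid)
    rewrite point-border (block x) (+-monoʳ-< 3 (borderIndex<3 (offset x)))
    with 3 + borderIndex (offset x) <? 3
  ... | yes 3+i<3 = contradiction 3+i<3 (m+n≮m 3 _)
  ... | no _ = cong (λ x → just x , nothing) (begin
    borderOffset (borderIndex (offset x)) + block x * p
      ≡⟨ cong (_+ block x * p) (borderOffset-borderIndex x ¬mid) ⟩
    offset x + block x * p
      ≡⟨ offset+block*p x ⟩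
    x ∎)
    where open ≡-Reasoning
  point-key-position (interior {x} {y} _ _) = cong₂ (λ x y → just x , just y)
    (trans (cong (_+ block x * p) ([m+n*d]/d≡n (offset x) (offset<p y))) (offset+block*p x))
    (trans (cong (_+ block y * p) ([m+n*d]%d≡m (offset x) (offset<p y))) (offset+block*p y))
  point-key-position (row {x} {y} cut _) = cong₂ (λ x y → just x , just y)
    (segmentPoint-segment (block y) x)
    (trans (cong (_+ block y * p) (sym cut)) (offset+block*p y))
  point-key-position (column {x} {y} cut _) = cong₂ (λ x y → just x , just y)
    (trans (cong (_+ block x * p) (sym cut)) (offset+block*p x))
    (segmentPoint-segment (suc (block x)) y)

  key-position-injective : ∀ {a b c a′ b′ c′} (s : Shape a b c) (s′ : Shape a′ b′ c′) →
    key s ≡ key s′ → position s ≡ position s′ → (a , b) ≡ (a′ , b′)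
  key-position-injective s s′ same-key same-position = begin
    _                           ≡⟨ sym (point-key-position s) ⟩
    point (key s) (position s)  ≡⟨ cong₂ point same-key same-position ⟩
    point (key s′) (position s′) ≡⟨ point-key-position s′ ⟩
    _                           ∎
    where open ≡-Reasoning

  InRange : ℕ → Set
  InRange x = block x < p * p

  position<7p² : ∀ {a b c} → MaybeAll.All InRange a → MaybeAll.All InRange b →
                 (s : Shape a b c) → position s < 7 * (p * p)
  position<7p² inRange-a inRange-b s =
    ≤-<-trans (subst (position s ≤_) (*-comm (p * p) 6) (bound inRange-a inRange-b s))
              (m<n+m (6 * (p * p)) (<-≤-trans (>-nonZero⁻¹ p) p≤p*p))
    where
    p≤p*p : p ≤ p * p
    p≤p*p = m≤m*n p p

    p+p≤p*p : p + p ≤ p * p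
    p+p≤p*p = subst (_≤ p * p) (cong (p +_) (+-identityʳ p)) (*-monoˡ-≤ p 1<p)

    small : ∀ {m} → m < p * p → m ≤ p * p * 6
    small m<p*p = ≤-trans (<⇒≤ m<p*p) (m≤m*n (p * p) 6)

    border : ∀ {i q} → i < 6 → q < p * p → suc (i + q * 6) ≤ p * p * 6
    border {q = q} i<6 q<p*p = ≤-trans (+-monoˡ-≤ (q * 6) i<6) (*-monoˡ-≤ 6 q<p*p)

    interior< : ∀ x y → offset y + offset x * p < p * p
    interior< x y = <-≤-trans (+-monoˡ-< (offset x * p) (offset<p y)) (*-monoˡ-≤ p (offset<p x))

    bound : ∀ {a b c} → MaybeAll.All InRange a → MaybeAll.All InRange b →
            (s : Shape a b c) → position s ≤ p * p * 6
    bound _ _ apex = z≤n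
    bound _ _ (top {y} _) = small (<-≤-trans (offset<p y) p≤p*p)
    bound _ (just q<p*p) (top-border {y} _) =
      border (<-≤-trans (borderIndex<3 (offset y)) (m≤m+n 3 3)) q<p*p
    bound _ _ (left {x} _) = small (<-≤-trans (offset<p x) p≤p*p)
    bound (just q<p*p) _ (left-border {x} _) = border (+-monoʳ-< 3 (borderIndex<3 (offset x))) q<p*p
    bound _ _ (interior {x} {y} _ _) = small (interior< x y)
    bound _ _ (row {x} {y} _ _) = small (<-≤-trans (segmentPosition<2p (block y) x) p+p≤p*p)
    bound _ _ (column {x} {y} _ _) = small (<-≤-trans (segmentPosition<2p (suc (block x)) y) p+p≤p*p)

FanAdj⇒FanClose : ∀ {m} {u v : Maybe (Fin m)} → FanAdj u v → FanClose (map toℕ u) (map toℕ v)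
FanAdj⇒FanClose {u = nothing} {just _} _ = tt
FanAdj⇒FanClose {u = just _} {nothing} _ = tt
FanAdj⇒FanClose {u = just i} {just j} (inj₁ j≡1+i) = subst (Close (toℕ i)) (sym j≡1+i) next
FanAdj⇒FanClose {u = just i} {just j} (inj₂ i≡1+j) = subst (λ k → Close k (toℕ j)) (sym i≡1+j) prev

⊠-Adj⇒FanClose : ∀ {m u v u′ v′} → Adj (Fan m ⊠ Fan m) (u , v) (u′ , v′) →
               FanClose (map toℕ u) (map toℕ u′) × FanClose (map toℕ v) (map toℕ v′)
⊠-Adj⇒FanClose {u = u} (inj₁ (refl , v~v′)) = FanClose-refl (map toℕ u) , FanAdj⇒FanClose v~v′
⊠-Adj⇒FanClose {v = v} (inj₂ (inj₁ (refl , u~u′))) = FanAdj⇒FanClose u~u′ , FanClose-refl (map toℕ v)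
⊠-Adj⇒FanClose (inj₂ (inj₂ (u~u′ , v~v′))) = FanAdj⇒FanClose u~u′ , FanAdj⇒FanClose v~v′

module FanColouring (n : ℕ) (1<n : 1 < n) where
  open Colouring n 1<n

  Grid : Graph
  Grid = Fan (n ^ 3) ⊠ Fan (n ^ 3)

  shapeOf : ∀ (w : V Grid) → ∃ (Shape (map toℕ (proj₁ w)) (map toℕ (proj₂ w)))
  shapeOf (u , v) = shape (map toℕ u) (map toℕ v)

  colour : V Grid → Fin 4
  colour w = proj₁ (shapeOf w)

  vertexKey : V Grid → Key
  vertexKey w = key (proj₂ (shapeOf w))

  vertexPosition : V Grid → ℕ
  vertexPosition w = position (proj₂ (shapeOf w))

  vertexKey-mono : ∀ {w w′} → Adj Grid w w′ → colour w ≡ colour w′ → vertexKey w ≡ vertexKey w′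
  vertexKey-mono {w} {w′} adj with u~u′ , v~v′ ← ⊠-Adj⇒FanClose adj =
    same-colour⇒same-key u~u′ v~v′ (shapeOf w) (shapeOf w′)

  vertexPosition-injective : ∀ {w w′} → vertexKey w ≡ vertexKey w′ →
                             vertexPosition w ≡ vertexPosition w′ → w ≡ w′
  vertexPosition-injective {u , v} {u′ , v′} same-key same-position
    with u≡u′ , v≡v′ ← ,-injective (key-position-injective _ _ same-key same-position) =
    cong₂ _,_ (map-injective toℕ-injective u≡u′) (map-injective toℕ-injective v≡v′)

  n³≡n*n*n : n ^ 3 ≡ n * n * n
  n³≡n*n*n = trans (cong (λ m → n * (n * m)) (*-identityʳ n)) (sym (*-assoc n n n))

  inRange : ∀ (u : Maybe (Fin (n ^ 3))) → MaybeAll.All InRange (map toℕ u)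
  inRange nothing = nothing
  inRange (just i) = just (m<n*o⇒m/o<n (subst (toℕ i <_) n³≡n*n*n (toℕ<n i)))

  vertexPosition<7n² : ∀ w → vertexPosition w < 7 * n ^ 2
  vertexPosition<7n² (u , v) =
    subst (λ m → vertexPosition (u , v) < 7 * (n * m)) (sym (*-identityʳ n))
      (position<7p² (inRange u) (inRange v) (proj₂ (shapeOf (u , v))))

proposition32 : ∀ (n : ℕ) → 2 ≤ n →
    Σ (V (Fan (n ^ 3) ⊠ Fan (n ^ 3)) → Fin 4) λ c →
      Clustering≤ (Fan (n ^ 3) ⊠ Fan (n ^ 3)) c (7 * n ^ 2)
proposition32 n 2≤n = colour ,
  clustering≤-by-labelling Grid colour vertexKey vertexPosition
    vertexKey-mono vertexPosition-injective vertexPosition<7n²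
  where open FanColouring n 2≤n
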